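{- Let $n\ge 1$ and $t\ge 2n-1$ be integers, let $P_t$ be the path with vertex set $[t]$ and edges $\{i,i+1\}$ for $1\le i\le t-1$, and let $\mathcal{F}=(I_1,\dots,I_k)$ with $k\ge n-1$ be a collection of (not necessarily distinct) independent sets of $P_t$, each of size at least $n-1$. Let $R$ and $C$ be the outputs of the greedy algorithm GRIS applied to $P_t$ (with vertices ordered $1,2,\dots,t$) and $\mathcal{F}$. If $|R|<n$, then $|R|=n-1$, and for every $I\in\mathcal{F}\setminus C$ we have $|I|=n-1$ and $|I\cap\{a,a+1\}|=1$ for every $a\in R$.
   Context: For a vertex $v$, its list is $C_{\mathcal{F}}(v)=\{I_i : v\in I_i\}$. The algorithm GRIS on a graph with ordered vertex set $a_1,\dots,a_t$ and collection $\mathcal{F}=(I_1,\dots,I_k)$: start with $R=C=\emptyset$; for $j=1,\dots,t$ in turn, if $C_{\mathcal{F}}(a_j)\setminus C\neq\emptyset$ and $R\cup\{a_j\}$ is an independent set, then add $a_j$ to $R$ and add to $C$ the member $I_i\in C_{\mathcal{F}}(a_j)\setminus C$ with minimal index $i$; otherwise do nothing. Output $R$ (a rainbow independent set) and the set $C$ of colors used (the greedy color set); $\mathcal{F}\setminus C$ denotes the members of $\mathcal{F}$ (by index) not in $C$. -}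

module Defs where

open import Data.Nat using (ℕ; zero; suc; _+_; _≡ᵇ_; _≤_)
open import Data.Bool using (Bool; true; false; if_then_else_; _∧_; _∨_; not; T)
open import Data.List using (List; []; _∷_; length; map; upTo)
open import Data.Maybe using (Maybe; just; nothing)
open import Data.Product using (_×_; _,_; proj₁; proj₂)

-- A vertex subset of P_t is given by its (Boolean) membership function on ℕ.
VSet : Set
VSet = ℕ → Bool

ind : Bool → ℕ
ind b = if b then 1 else 0

size : VSet → ℕ → ℕ
size I zero = 0
size I (suc m) = ind (I (suc m)) + size I m

IsIndepPath : ℕ → VSet → Set
IsIndepPath t I =
  (∀ v → T (I v) → 1 ≤ v × v ≤ t) ×
  (∀ v → T (I v) → T (I (suc v)) → Data.Empty.⊥)
  where import Data.Empty

adjᵇ : ℕ → ℕ → Bool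
adjᵇ x y = (suc x ≡ᵇ y) ∨ (suc y ≡ᵇ x)

memᵇ : ℕ → List ℕ → Bool
memᵇ x [] = false
memᵇ x (y ∷ ys) = (y ≡ᵇ x) ∨ memᵇ x ys

-- R ∪ {a} is independent in P_t, given R independent: a is adjacent to no r ∈ R
canAddᵇ : List ℕ → ℕ → Bool
canAddᵇ [] a = true
canAddᵇ (r ∷ R) a = not (adjᵇ r a) ∧ canAddᵇ R a

-- minimal (0-based) index i ≥ off of a member of the list F with a ∈ I_i and i ∉ C
firstFree : List VSet → ℕ → List ℕ → ℕ → Maybe ℕ
firstFree [] off C a = nothing
firstFree (I ∷ F) off C a =
  if I a ∧ not (memᵇ off C) then just off else firstFree F (suc off) C a

grisStep : List VSet → ℕ → List ℕ × List ℕ → List ℕ × List ℕ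
grisStep F a (R , C) with firstFree F 0 C a
... | nothing = (R , C)
... | just i = if canAddᵇ R a then (a ∷ R , i ∷ C) else (R , C)

grisRun : List VSet → List ℕ → List ℕ × List ℕ → List ℕ × List ℕ
grisRun F [] s = s
grisRun F (a ∷ as) s = grisRun F as (grisStep F a s)

vertices : ℕ → List ℕ
vertices t = map suc (upTo t)

-- GRIS on P_t with order 1,…,t and collection F = (I_1,…,I_k)
-- (colors are recorded as 0-based indices into F).
-- Output: (R , C).
GRIS : ℕ → List VSet → List ℕ × List ℕ
GRIS t F = grisRun F (vertices t) ([] , [])

module Submission where

-- If colour I is never used by GRIS, then every vertex v ∈ I was met while I was still
-- available, so v could only have been rejected because a neighbour was already in R;
-- as R then held only vertices smaller than v, that neighbour is v - 1. Hence
-- I ⊆ R ∪ (R + 1) and |I| ≤ Σ_{a ∈ R} |I ∩ {a, a+1}| ≤ |R|, each term being at most 1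
-- since I is independent. As |R| = |C|, a run with |R| < n - 1 ≤ k leaves some colour
-- unused, against |I| ≥ n - 1; so |R| = n - 1 and, for an unused colour, all these
-- inequalities are equalities.

open import Defs
open import Data.Bool using (true; false; T; _∧_; _∨_; not)
open import Data.Bool.Properties using (T-∨; T-∧; T-≡)
open import Data.Empty using (⊥-elim)
open import Data.Fin using (Fin; toℕ) renaming (zero to fzero; suc to fsuc)
open import Data.Fin.Properties using (¬∀⟶∃¬; injective⇒≤; toℕ-injective)
open import Data.List using (List; []; _∷_; _++_; length; lookup; map; upTo)
open import Data.List.Properties using (upTo-∷ʳ; map-++; map-∘)
open import Data.List.Membership.Propositional using (_∈_; _∉_)
open import Data.List.Membership.Propositional.Properties using (∈-map⁺)
open import Data.List.Membership.Setoid.Properties using (index-injective)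
open import Data.List.Relation.Unary.Any using (here; there; index)
open import Data.Maybe using (just; nothing)
open import Data.Nat using (ℕ; zero; suc; _+_; _∸_; _*_; _≤_; _<_; _≡ᵇ_; z≤n; s≤s)
open import Data.Nat.ListAction using (sum)
open import Data.Nat.Properties
open import Algebra.Properties.CommutativeSemigroup +-commutativeSemigroup using (interchange)
open import Data.List.Membership.DecPropositional _≟_ using (_∈?_)
open import Data.Product using (_×_; _,_; proj₁; proj₂; ∃; ∃-syntax)
open import Data.Sum using (_⊎_; inj₁; inj₂)
import Data.Sum as Sum
open import Function using (_∘_; Equivalence)
open import Relation.Binary.PropositionalEquality
  using (_≡_; _≢_; refl; sym; trans; cong; subst; setoid)

open Equivalence using (to; from)

memᵇ⇒∈ : ∀ {x} C → T (memᵇ x C) → x ∈ C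
memᵇ⇒∈ {x} (y ∷ C) h with to T-∨ h
... | inj₁ y≡x = here (sym (≡ᵇ⇒≡ y x y≡x))
... | inj₂ x∈C = there (memᵇ⇒∈ C x∈C)

∈⇒memᵇ : ∀ {x C} → x ∈ C → T (memᵇ x C)
∈⇒memᵇ {x} (here refl) = from T-∨ (inj₁ (≡⇒≡ᵇ x x refl))
∈⇒memᵇ (there x∈C) = from T-∨ (inj₂ (∈⇒memᵇ x∈C))

ind-≤-∧+∧ : ∀ b c d → (T b → T c ⊎ T d) → ind b ≤ ind (c ∧ b) + ind (d ∧ b)
ind-≤-∧+∧ false c d _ = z≤n
ind-≤-∧+∧ true true d _ = s≤s z≤n
ind-≤-∧+∧ true false true _ = ≤-refl
ind-≤-∧+∧ true false false h with h _
... | inj₁ ()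
... | inj₂ ()

ind-∨∧≤ : ∀ x y b → ind ((x ∨ y) ∧ b) ≤ ind (x ∧ b) + ind (y ∧ b)
ind-∨∧≤ true y true = s≤s z≤n
ind-∨∧≤ true y false = z≤n
ind-∨∧≤ false y b = ≤-refl

ind-∧≤ : ∀ b c → ind (b ∧ c) ≤ ind c
ind-∧≤ true c = ≤-refl
ind-∧≤ false c = z≤n

size-≤-+ : ∀ p q r t → (∀ u → u < t → ind (p (suc u)) ≤ ind (q (suc u)) + ind (r (suc u))) →
           size p t ≤ size q t + size r t
size-≤-+ p q r zero _ = z≤n
size-≤-+ p q r (suc t) h = begin
  ind (p (suc t)) + size p t                              ≤⟨ +-mono-≤ (h t ≤-refl) (size-≤-+ p q r t (λ u → h u ∘ m<n⇒m<1+n)) ⟩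
  (ind (q (suc t)) + ind (r (suc t))) + (size q t + size r t) ≡⟨ interchange (ind (q (suc t))) (ind (r (suc t))) (size q t) (size r t) ⟩
  size q (suc t) + size r (suc t)                         ∎
  where open ≤-Reasoning

size-≡0 : ∀ p t → (∀ v → T (p v) → t < v) → size p t ≡ 0
size-≡0 p zero _ = refl
size-≡0 p (suc t) above with p (suc t) | above (suc t)
... | true | h = ⊥-elim (n≮n _ (h _))
... | false | _ = size-≡0 p t (λ v → <-trans (n<1+n t) ∘ above v)

size-≤1 : ∀ p a t → (∀ v → T (p v) → v ≡ a) → size p t ≤ 1
size-≤1 p a zero _ = z≤n
size-≤1 p a (suc t) only-a with p (suc t) | only-a (suc t)
... | false | _ = size-≤1 p a t only-a
... | true | h = ≤-reflexive (cong suc (size-≡0 p t above-t))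
  where
  above-t : ∀ v → T (p v) → t < v
  above-t v pv = ≤-reflexive (trans (h _) (sym (only-a v pv)))

size-≤-ind-at : ∀ p a t → (∀ v → T (p v) → v ≡ a) → size p t ≤ ind (p a)
size-≤-ind-at p a t only-a with p a in pa
... | true = size-≤1 p a t only-a
... | false = ≤-reflexive (size-≡0 p t λ v pv → ⊥-elim (subst T pa (subst (T ∘ p) (only-a v pv) pv)))

size-∈∧≤sum : ∀ p S t → size (λ v → memᵇ v S ∧ p v) t ≤ sum (map (ind ∘ p) S)
size-∈∧≤sum p [] t = ≤-reflexive (size-≡0 _ t λ _ ())
size-∈∧≤sum p (a ∷ S) t = begin
  size (λ v → memᵇ v (a ∷ S) ∧ p v) t                         ≤⟨ size-≤-+ _ at-a in-S t (λ u _ → ind-∨∧≤ (a ≡ᵇ suc u) _ _) ⟩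
  size at-a t + size in-S t                                   ≤⟨ +-mono-≤ at-a-bound (size-∈∧≤sum p S t) ⟩
  ind (p a) + sum (map (ind ∘ p) S)                           ∎
  where
  open ≤-Reasoning
  at-a in-S : VSet
  at-a v = (a ≡ᵇ v) ∧ p v
  in-S v = memᵇ v S ∧ p v
  at-a-bound : size at-a t ≤ ind (p a)
  at-a-bound = ≤-trans (size-≤-ind-at at-a a t λ v h → sym (≡ᵇ⇒≡ a v (proj₁ (to T-∧ h))))
                       (ind-∧≤ (a ≡ᵇ a) (p a))

edgeCount : VSet → ℕ → ℕ
edgeCount I a = ind (I a) + ind (I (suc a))

sum-map-+ : ∀ (f g : ℕ → ℕ) xs → sum (map (λ x → f x + g x) xs) ≡ sum (map f xs) + sum (map g xs)
sum-map-+ f g [] = refl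
sum-map-+ f g (x ∷ xs) =
  trans (cong (f x + g x +_) (sum-map-+ f g xs)) (interchange (f x) (g x) (sum (map f xs)) (sum (map g xs)))

covered⇒size≤sum-edgeCount : ∀ I R t → (∀ u → u < t → T (I (suc u)) → suc u ∈ R ⊎ u ∈ R) →
                             size I t ≤ sum (map (edgeCount I) R)
covered⇒size≤sum-edgeCount I R t covered = begin
  size I t                                                ≤⟨ size-≤-+ I inR inR+1 t split ⟩
  size inR t + size inR+1 t                               ≤⟨ +-mono-≤ (size-∈∧≤sum I R t) (size-∈∧≤sum I (map suc R) t) ⟩
  sum (map (ind ∘ I) R) + sum (map (ind ∘ I) (map suc R)) ≡⟨ cong ((sum (map (ind ∘ I) R) +_) ∘ sum) (map-∘ R) ⟨
  sum (map (ind ∘ I) R) + sum (map (ind ∘ I ∘ suc) R)     ≡⟨ sum-map-+ (ind ∘ I) (ind ∘ I ∘ suc) R ⟨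
  sum (map (edgeCount I) R)                               ∎
  where
  open ≤-Reasoning
  inR inR+1 : VSet
  inR v = memᵇ v R ∧ I v
  inR+1 v = memᵇ v (map suc R) ∧ I v
  split : ∀ u → u < t → ind (I (suc u)) ≤ ind (inR (suc u)) + ind (inR+1 (suc u))
  split u u<t = ind-≤-∧+∧ _ _ _ (Sum.map ∈⇒memᵇ (∈⇒memᵇ ∘ ∈-map⁺ suc) ∘ covered u u<t)

edgeCount≤1 : ∀ {t I} → IsIndepPath t I → ∀ a → edgeCount I a ≤ 1
edgeCount≤1 {I = I} (_ , no-edge) a with I a | I (suc a) | no-edge a
... | true  | true  | no = ⊥-elim (no _ _)
... | true  | false | _  = ≤-refl
... | false | true  | _  = ≤-refl
... | false | false | _  = z≤n

sum-map≤length : ∀ (f : ℕ → ℕ) xs → (∀ x → f x ≤ 1) → sum (map f xs) ≤ length xs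
sum-map≤length f [] _ = z≤n
sum-map≤length f (x ∷ xs) f≤1 = +-mono-≤ (f≤1 x) (sum-map≤length f xs f≤1)

≤1-+-≡suc : ∀ {m s l} → m ≤ 1 → s ≤ l → m + s ≡ suc l → m ≡ 1 × s ≡ l
≤1-+-≡suc z≤n s≤l eq = ⊥-elim (1+n≰n (subst (_≤ _) eq s≤l))
≤1-+-≡suc (s≤s z≤n) _ eq = refl , suc-injective eq

sum-map≡length⇒≡1 : ∀ (f : ℕ → ℕ) xs → (∀ x → f x ≤ 1) → sum (map f xs) ≡ length xs →
                    ∀ x → x ∈ xs → f x ≡ 1
sum-map≡length⇒≡1 f (y ∷ ys) f≤1 eq x x∈y∷ys
  with fy≡1 , rest ← ≤1-+-≡suc (f≤1 y) (sum-map≤length f ys f≤1) eq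
  with x∈y∷ys
... | here refl = fy≡1
... | there x∈ys = sum-map≡length⇒≡1 f ys f≤1 rest x x∈ys

fresh-index : ∀ {m} (C : List ℕ) → length C < m → ∃ λ (i : Fin m) → toℕ i ∉ C
fresh-index {m} C |C|<m = ¬∀⟶∃¬ m (λ i → toℕ i ∈ C) (λ i → toℕ i ∈? C) λ all∈C →
  <⇒≱ |C|<m (injective⇒≤ {f = λ i → index (all∈C i)} λ eq →
    toℕ-injective (index-injective (setoid ℕ) (all∈C _) (all∈C _) eq))

firstFree-finds : ∀ F off C a (i : Fin (length F)) → T (lookup F i a) → toℕ i + off ∉ C →
                  firstFree F off C a ≢ nothing
firstFree-finds (I ∷ F) off C a fzero Ia off∉C with I a | memᵇ off C in off∈ᵇC
... | true | true  = λ _ → off∉C (memᵇ⇒∈ C (from T-≡ off∈ᵇC))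
... | true | false = λ ()
firstFree-finds (I ∷ F) off C a (fsuc i) Ia i∉C with I a ∧ not (memᵇ off C)
... | true  = λ ()
... | false = firstFree-finds F (suc off) C a i Ia (i∉C ∘ subst (_∈ C) (+-suc (toℕ i) off))

canAddᵇ≡false⇒neighbour : ∀ R a → canAddᵇ R a ≡ false → ∃[ r ] r ∈ R × (suc r ≡ a ⊎ suc a ≡ r)
canAddᵇ≡false⇒neighbour (r ∷ R) a blocked with adjᵇ r a in r~a
... | true  = r , here refl , Sum.map (≡ᵇ⇒≡ _ _) (≡ᵇ⇒≡ _ _) (to T-∨ (from T-≡ r~a))
... | false with r′ , r′∈R , r′~a ← canAddᵇ≡false⇒neighbour R a blocked = r′ , there r′∈R , r′~a

data Step (F : List VSet) (a : ℕ) (s : List ℕ × List ℕ) : List ℕ × List ℕ → Set where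
  skipped : firstFree F 0 (proj₂ s) a ≡ nothing ⊎ canAddᵇ (proj₁ s) a ≡ false → Step F a s s
  added   : ∀ i → Step F a s (a ∷ proj₁ s , i ∷ proj₂ s)

grisStep-view : ∀ F a s → Step F a s (grisStep F a s)
grisStep-view F a (R , C) with firstFree F 0 C a in free
... | nothing = skipped (inj₁ free)
... | just i with canAddᵇ R a in ok
...   | true  = added i
...   | false = skipped (inj₂ ok)

grisRun-++ : ∀ F xs ys s → grisRun F (xs ++ ys) s ≡ grisRun F ys (grisRun F xs s)
grisRun-++ F [] ys s = refl
grisRun-++ F (x ∷ xs) ys s = grisRun-++ F xs ys (grisStep F x s)

vertices-suc : ∀ t → vertices (suc t) ≡ vertices t ++ suc t ∷ []
vertices-suc t = trans (cong (map suc) (sym (upTo-∷ʳ t))) (map-++ suc (upTo t) (t ∷ []))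

GRIS-suc : ∀ F t → GRIS (suc t) F ≡ grisStep F (suc t) (GRIS t F)
GRIS-suc F t = trans (cong (λ vs → grisRun F vs ([] , [])) (vertices-suc t))
                     (grisRun-++ F (vertices t) (suc t ∷ []) ([] , []))

module _ (F : List VSet) where

  rainbow colours : ℕ → List ℕ
  rainbow t = proj₁ (GRIS t F)
  colours t = proj₂ (GRIS t F)

  GRIS-step : ∀ t → Step F (suc t) (GRIS t F) (GRIS (suc t) F)
  GRIS-step t = subst (Step F (suc t) (GRIS t F)) (sym (GRIS-suc F t)) (grisStep-view F (suc t) (GRIS t F))

  length-rainbow≡length-colours : ∀ t → length (rainbow t) ≡ length (colours t)
  length-rainbow≡length-colours zero = refl
  length-rainbow≡length-colours (suc t) with GRIS (suc t) F | GRIS-step t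
  ... | _ | skipped _ = length-rainbow≡length-colours t
  ... | _ | added _   = cong suc (length-rainbow≡length-colours t)

  colours-⊆-suc : ∀ {x} t → x ∈ colours t → x ∈ colours (suc t)
  colours-⊆-suc t x∈C with GRIS (suc t) F | GRIS-step t
  ... | _ | skipped _ = x∈C
  ... | _ | added _   = there x∈C

  rainbow-⊆-suc : ∀ {x} t → x ∈ rainbow t → x ∈ rainbow (suc t)
  rainbow-⊆-suc t x∈R with GRIS (suc t) F | GRIS-step t
  ... | _ | skipped _ = x∈R
  ... | _ | added _   = there x∈R

  rainbow-≤ : ∀ {r} t → r ∈ rainbow t → r ≤ t
  rainbow-≤ (suc t) r∈R with GRIS (suc t) F | GRIS-step t
  ... | _ | skipped _ = m≤n⇒m≤1+n (rainbow-≤ t r∈R)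
  ... | _ | added _   with r∈R
  ...   | here refl  = ≤-refl
  ...   | there r∈R′ = m≤n⇒m≤1+n (rainbow-≤ t r∈R′)

  last-vertex-covered : ∀ t (i : Fin (length F)) → toℕ i ∉ colours (suc t) → T (lookup F i (suc t)) →
                        suc t ∈ rainbow (suc t) ⊎ t ∈ rainbow (suc t)
  last-vertex-covered t i i∉C Iv with GRIS (suc t) F | GRIS-step t
  ... | _ | added _ = inj₁ (here refl)
  ... | _ | skipped (inj₁ no-free) =
    ⊥-elim (firstFree-finds F 0 (colours t) (suc t) i Iv (i∉C ∘ subst (_∈ colours t) (+-identityʳ (toℕ i))) no-free)
  ... | _ | skipped (inj₂ blocked)
    with r , r∈R , r~t+1 ← canAddᵇ≡false⇒neighbour (rainbow t) (suc t) blocked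
    with r~t+1
  ...   | inj₁ refl = inj₂ r∈R
  ...   | inj₂ refl = ⊥-elim (1+n≰n (m≤n⇒m≤1+n (rainbow-≤ t r∈R)))

  free-colour-covered : ∀ t (i : Fin (length F)) → toℕ i ∉ colours t →
                        ∀ u → u < t → T (lookup F i (suc u)) → suc u ∈ rainbow t ⊎ u ∈ rainbow t
  free-colour-covered (suc t) i i∉C u u<1+t Iu with m<1+n⇒m<n∨m≡n u<1+t
  ... | inj₁ u<t  = Sum.map (rainbow-⊆-suc t) (rainbow-⊆-suc t)
                      (free-colour-covered t i (i∉C ∘ colours-⊆-suc t) u u<t Iu)
  ... | inj₂ refl = last-vertex-covered t i i∉C Iu

  free-colour-size≤sum-edgeCount : ∀ t (i : Fin (length F)) → toℕ i ∉ colours t →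
                                   size (lookup F i) t ≤ sum (map (edgeCount (lookup F i)) (rainbow t))
  free-colour-size≤sum-edgeCount t i i∉C =
    covered⇒size≤sum-edgeCount (lookup F i) (rainbow t) t (free-colour-covered t i i∉C)

lemma2p1 : (n t : ℕ) (F : List VSet) →
    1 ≤ n → 2 * n ∸ 1 ≤ t → n ∸ 1 ≤ length F →
    (∀ (i : Fin (length F)) → IsIndepPath t (lookup F i)) →
    (∀ (i : Fin (length F)) → n ∸ 1 ≤ size (lookup F i) t) →
    length (proj₁ (GRIS t F)) < n →
    (length (proj₁ (GRIS t F)) ≡ n ∸ 1) ×
    (∀ (i : Fin (length F)) → toℕ i ∉ proj₂ (GRIS t F) →
      (size (lookup F i) t ≡ n ∸ 1) ×
      (∀ a → a ∈ proj₁ (GRIS t F) →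
        ind (lookup F i a) + ind (lookup F i (a + 1)) ≡ 1))
lemma2p1 n t F _ _ n∸1≤k indep large |R|<n = |R|≡n∸1 , λ i i∉C → size≡n∸1 i i∉C , tight i i∉C
  where
  R = rainbow F t
  C = colours F t

  size≤sum : ∀ i → toℕ i ∉ C → size (lookup F i) t ≤ sum (map (edgeCount (lookup F i)) R)
  size≤sum = free-colour-size≤sum-edgeCount F t

  sum≤|R| : ∀ i → sum (map (edgeCount (lookup F i)) R) ≤ length R
  sum≤|R| i = sum-map≤length (edgeCount (lookup F i)) R (edgeCount≤1 (indep i))

  |R|≡n∸1 : length R ≡ n ∸ 1
  |R|≡n∸1 = ≤-antisym (∸-monoˡ-≤ 1 |R|<n) (≮⇒≥ λ |R|<n∸1 →
    let |C|<k = subst (_< length F) (length-rainbow≡length-colours F t) (<-≤-trans |R|<n∸1 n∸1≤k)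
        i , i∉C = fresh-index C |C|<k
    in <⇒≱ |R|<n∸1 (≤-trans (large i) (≤-trans (size≤sum i i∉C) (sum≤|R| i))))

  size≡n∸1 : ∀ i → toℕ i ∉ C → size (lookup F i) t ≡ n ∸ 1
  size≡n∸1 i i∉C = ≤-antisym (≤-trans (size≤sum i i∉C) (≤-trans (sum≤|R| i) (≤-reflexive |R|≡n∸1))) (large i)

  tight : ∀ i → toℕ i ∉ C → ∀ a → a ∈ R → ind (lookup F i a) + ind (lookup F i (a + 1)) ≡ 1
  tight i i∉C a a∈R = subst (λ b → ind (lookup F i a) + ind (lookup F i b) ≡ 1) (+-comm 1 a)
    (sum-map≡length⇒≡1 (edgeCount (lookup F i)) R (edgeCount≤1 (indep i)) sum≡|R| a a∈R)
    where
    sum≡|R| : sum (map (edgeCount (lookup F i)) R) ≡ length R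
    sum≡|R| = ≤-antisym (sum≤|R| i)
      (≤-trans (≤-reflexive (trans |R|≡n∸1 (sym (size≡n∸1 i i∉C)))) (size≤sum i i∉C))
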